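{- Let $\mathrm{Pow}:\mathbf{Rel}^{op}\rightarrow \mathbf{OA}$ be the functor that associates to every set $X$ the o-algebra $\mathrm{Pow}(X)$ and to every relation $R\subseteq X\times Y$ its inverse image $\mathrm{Pow}(R)=R^{ -1}:\mathrm{Pow}(Y)\to\mathrm{Pow}(X)$. Then $\mathrm{Pow}$ is a full and faithful functor. Moreover, $\mathrm{Pow}(R^\dagger)=(\mathrm{Pow}(R))^\dagger$.
   Context: Work in intuitionistic logic without choice. A positivity predicate on a complete lattice $L$ is a unary predicate $\mathrm{Pos}$ such that: (i) $\mathrm{Pos}(x)$ and $x\le y$ imply $\mathrm{Pos}(y)$; (ii) $\mathrm{Pos}(\bigvee X)$ implies $\mathrm{Pos}(x)$ for some $x\in X$; (iii) if $\mathrm{Pos}(x)\Rightarrow x\le y$, then $x\le y$. An o-algebra is a frame $L$ with a positivity predicate such that for all $x,y$: if $\mathrm{Pos}(z\wedge x)\Rightarrow\mathrm{Pos}(z\wedge y)$ for every $z\in L$, then $x\le y$. Write $x\bowtie y$ (overlap) for $\mathrm{Pos}(x\wedge y)$. Functions $f:L\to M$, $g:M\to L$ are symmetric if $f(x)\bowtie y\iff x\bowtie g(y)$; $f$ is symmetrizable if it has a (unique) symmetric $f^\dagger$. $\mathbf{OA}$ is the category of o-algebras and symmetrizable functions. Each powerset $\mathrm{Pow}(X)$ is an o-algebra with $\mathrm{Pos}(A)$ meaning "$A$ is inhabited". $\mathbf{Rel}$ is the category of sets and binary relations, with $x(S\circ R)z\iff\exists y(xRy\land ySz)$. For $R\subseteq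 X\times Y$, $R^{ -1}(Y')=\{x\in X\mid \exists y\in Y'\,(xRy)\}$, and $R^\dagger\subseteq Y\times X$ is the converse relation ($yR^\dagger x$ iff $xRy$). -}

module Defs where

open import Data.Product using (Σ; ∃; _×_; _,_)
open import Function.Bundles using (_⇔_)
open import Relation.Binary.PropositionalEquality using (_≡_)

-- Powerset o-algebra Pow(X): subsets of X as predicates X → Set.
-- Pos(A) := A is inhabited; the lattice order is inclusion.
Pow : Set → Set₁
Pow X = X → Set

Pos : {X : Set} → Pow X → Set
Pos {X} A = ∃ λ (x : X) → A x

_∩_ : {X : Set} → Pow X → Pow X → Pow X
(A ∩ B) x = A x × B x

_≬_ : {X : Set} → Pow X → Pow X → Set
A ≬ B = Pos (A ∩ B)

_⊆_ : {X : Set} → Pow X → Pow X → Set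
A ⊆ B = ∀ x → A x → B x

_≐_ : {X : Set} → Pow X → Pow X → Set
A ≐ B = (A ⊆ B) × (B ⊆ A)

Symmetric : {X Y : Set} → (Pow X → Pow Y) → (Pow Y → Pow X) → Set₁
Symmetric f g = ∀ A B → (f A ≬ B) ⇔ (A ≬ g B)

-- f is symmetrizable, i.e. a morphism Pow(X) → Pow(Y) in OA
Symmetrizable : {X Y : Set} → (Pow X → Pow Y) → Set₁
Symmetrizable {X} {Y} f = Σ (Pow Y → Pow X) λ g → Symmetric f g

_≗ₚ_ : {X Y : Set} → (Pow X → Pow Y) → (Pow X → Pow Y) → Set₁
f ≗ₚ g = ∀ A → f A ≐ g A

Rel : Set → Set → Set₁
Rel X Y = X → Y → Set

_≗ᵣ_ : {X Y : Set} → Rel X Y → Rel X Y → Set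
R ≗ᵣ S = ∀ x y → R x y ⇔ S x y

idRel : (X : Set) → Rel X X
idRel X x x' = x ≡ x'

_∘ᵣ_ : {X Y Z : Set} → Rel Y Z → Rel X Y → Rel X Z
(S ∘ᵣ R) x z = ∃ λ y → R x y × S y z

_† : {X Y : Set} → Rel X Y → Rel Y X
(R †) y x = R x y

PowR : {X Y : Set} → Rel X Y → Pow Y → Pow X
PowR R B x = ∃ λ y → R x y × B y

module Submission where

-- Everything rests on one observation: a subset is determined by its overlaps with
-- singletons, since A ≬ {x} holds exactly when x ∈ A.  Consequently
--   * R⁻¹({y}) is the fibre {x | x R y}, so R is recovered from Pow(R) (faithfulness);
--   * for a symmetric pair (f, g) the overlap condition, read on singletons, says
--     x ∈ f({y}) ⇔ y ∈ g({x}), and read on an arbitrary B it says that f(B) is the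
--     union of the f({y}) for y ∈ B; hence f is the inverse image of the relation
--     x R_f y :⇔ x ∈ f({y}) (fullness).

open import Defs
open import Data.Product using (Σ; _×_; _,_)
open import Function.Bundles using (_⇔_; mk⇔; Equivalence)
open import Function.Properties.Equivalence using (⇔-setoid) renaming (sym to ⇔-sym)
open import Level using (0ℓ)
open import Relation.Binary.PropositionalEquality using (_≡_; refl)
open import Relation.Binary.Reasoning.Setoid (⇔-setoid 0ℓ)

open Equivalence using (to; from)

⟦_⟧ : {X : Set} → X → Pow X
⟦ x ⟧ x′ = x ≡ x′

-- A subset overlaps {x} exactly when it contains x; this is how points are probed.
overlap-singletonʳ : {X : Set} (A : Pow X) (x : X) → (A ≬ ⟦ x ⟧) ⇔ A x
overlap-singletonʳ A x = mk⇔ (λ { (_ , a , refl) → a }) (λ a → x , a , refl)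

overlap-singletonˡ : {X : Set} (A : Pow X) (x : X) → (⟦ x ⟧ ≬ A) ⇔ A x
overlap-singletonˡ A x = mk⇔ (λ { (_ , refl , a) → a }) (λ a → x , refl , a)

pointwise⇒≐ : {X : Set} {A B : Pow X} → (∀ x → A x ⇔ B x) → A ≐ B
pointwise⇒≐ e = (λ x → to (e x)) , (λ x → from (e x))

≐⇒pointwise : {X : Set} {A B : Pow X} → A ≐ B → ∀ x → A x ⇔ B x
≐⇒pointwise (A⊆B , B⊆A) x = mk⇔ (A⊆B x) (B⊆A x)

-- Pow(R†) = Pow(R)†: both sides of the overlap condition say ∃ x ∈ A, y ∈ B with x R y.
inverse-image-symmetric : {X Y : Set} (R : Rel X Y) → Symmetric (PowR R) (PowR (R †))
inverse-image-symmetric R A B =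
  mk⇔ (λ { (y , (x , r , a) , b) → x , a , y , r , b })
      (λ { (x , a , y , r , b) → y , (x , r , a) , b })

inverse-image-id : (X : Set) → PowR (idRel X) ≗ₚ (λ A → A)
inverse-image-id X A = (λ { x (_ , refl , a) → a }) , (λ x a → x , refl , a)

inverse-image-∘ : {X Y Z : Set} (R : Rel X Y) (S : Rel Y Z) →
                  PowR (S ∘ᵣ R) ≗ₚ (λ C → PowR R (PowR S C))
inverse-image-∘ R S C = (λ { x (z , (y , r , s) , c) → y , r , z , s , c })
                      , (λ { x (y , r , z , s , c) → z , (y , r , s) , c })

inverse-image-singleton : {X Y : Set} (R : Rel X Y) (x : X) (y : Y) → PowR R ⟦ y ⟧ x ⇔ R x y
inverse-image-singleton R x y = mk⇔ (λ { (_ , r , refl) → r }) (λ r → y , r , refl)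

-- Faithfulness: R is recovered from R⁻¹ through its fibres.
inverse-image-faithful : {X Y : Set} (R S : Rel X Y) → PowR R ≗ₚ PowR S → R ≗ᵣ S
inverse-image-faithful R S e x y = begin
  R x y            ≈⟨ ⇔-sym (inverse-image-singleton R x y) ⟩
  PowR R ⟦ y ⟧ x   ≈⟨ ≐⇒pointwise (e ⟦ y ⟧) x ⟩
  PowR S ⟦ y ⟧ x   ≈⟨ inverse-image-singleton S x y ⟩
  S x y            ∎

graph : {X Y : Set} → (Pow Y → Pow X) → Rel X Y
graph f x y = f ⟦ y ⟧ x

symmetric-graphs : {X Y : Set} {f : Pow Y → Pow X} {g : Pow X → Pow Y} →
                   Symmetric f g → ∀ x y → g ⟦ x ⟧ y ⇔ graph f x y
symmetric-graphs {f = f} {g} f⊣g x y = begin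
  g ⟦ x ⟧ y          ≈⟨ ⇔-sym (overlap-singletonˡ (g ⟦ x ⟧) y) ⟩
  ⟦ y ⟧ ≬ g ⟦ x ⟧    ≈⟨ ⇔-sym (f⊣g ⟦ y ⟧ ⟦ x ⟧) ⟩
  f ⟦ y ⟧ ≬ ⟦ x ⟧    ≈⟨ overlap-singletonʳ (f ⟦ y ⟧) x ⟩
  f ⟦ y ⟧ x          ∎

-- Every symmetrizable map is the inverse image of its graph: x ∈ f(B) iff B meets
-- g({x}), i.e. iff some y ∈ B has x ∈ f({y}).
symmetric-is-inverse-image : {X Y : Set} {f : Pow Y → Pow X} {g : Pow X → Pow Y} →
                             Symmetric f g → PowR (graph f) ≗ₚ f
symmetric-is-inverse-image {f = f} {g} f⊣g B = pointwise⇒≐ λ x → begin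
  PowR (graph f) B x   ≈⟨ mk⇔ (λ { (y , r , b) → y , b , from (graph≅ x y) r })
                              (λ { (y , b , s) → y , to (graph≅ x y) s , b }) ⟩
  B ≬ g ⟦ x ⟧          ≈⟨ ⇔-sym (f⊣g B ⟦ x ⟧) ⟩
  f B ≬ ⟦ x ⟧          ≈⟨ overlap-singletonʳ (f B) x ⟩
  f B x                ∎
  where
  graph≅ : ∀ x y → g ⟦ x ⟧ y ⇔ graph f x y
  graph≅ = symmetric-graphs f⊣g

inverse-image-full : {X Y : Set} (f : Pow Y → Pow X) → Symmetrizable f →
                     Σ (Rel X Y) (λ R → PowR R ≗ₚ f)
inverse-image-full f (_ , f⊣g) = graph f , symmetric-is-inverse-image f⊣g

proposition4p1 :
    ((X Y : Set) (R : Rel X Y) → Symmetric (PowR R) (PowR (R †)))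
    × ((X : Set) → PowR (idRel X) ≗ₚ (λ A → A))
    × ((X Y Z : Set) (R : Rel X Y) (S : Rel Y Z) → PowR (S ∘ᵣ R) ≗ₚ (λ C → PowR R (PowR S C)))
    × ((X Y : Set) (f : Pow Y → Pow X) → Symmetrizable f → Σ (Rel X Y) (λ R → PowR R ≗ₚ f))
    × ((X Y : Set) (R S : Rel X Y) → PowR R ≗ₚ PowR S → R ≗ᵣ S)
proposition4p1 =
    (λ _ _ → inverse-image-symmetric)
  , inverse-image-id
  , (λ _ _ _ → inverse-image-∘)
  , (λ _ _ → inverse-image-full)
  , (λ _ _ → inverse-image-faithful)
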